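{- Let $H$ be a schematic extended Herbrand-sequent and $\sigma$ its canonical substitution. Then $\sigma$ is a solution of $H$.
   Context: Fix a quantifier-free $F$ with one free variable $x$; $A\{x\mapsto t\}$ denotes substitution. A schematic extended Herbrand-sequent of $\forall x\,F\rightarrow$ is $H=F\{x\mapsto u_1\},\ldots,F\{x\mapsto u_m\},X_1(\alpha_1)\supset\bigwedge_{j=1}^{k_1}X_1(s_{1,j}),\ldots,X_n(\alpha_n)\supset\bigwedge_{j=1}^{k_n}X_n(s_{n,j})\rightarrow$ with $X_i$ monadic second-order variables, $\Var(s_{i,j})\subseteq\{\alpha_{i+1},\ldots,\alpha_n\}$, such that $\bigwedge_{t\in L(\mathrm{G}(H))}F\{x\mapsto t\}\rightarrow$ is a tautology, where $\mathrm{G}(H)$ is the totally rigid grammar with productions $\tau\to u_i$, $\alpha_i\to s_{i,j}$ and $L(\mathrm{G}(H))$ its language. A solution is a substitution $[X_i\mapsto\lambda\alpha_i.A_i]_{i=1}^n$ with $\Var(A_i)\subseteq\{\alpha_i,\ldots,\alpha_n\}$ making $H$ a tautology. The canonical substitution is $[X_i\mapsto\lambda\alpha_i.C_i]_{i=1}^n$ with $C_1=\bigwedge_{i=1}^mF\{x\mapsto u_i\}$ and $C_{i+1}=\bigwedge_{j=1}^{k_i}C_i\{\alpha_i\mapsto s_{i,j}\}$. -}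

module Defs where

open import Data.Nat as ℕ using (ℕ; zero; suc; _≡ᵇ_; _<?_)
open import Data.Fin as Fin using (Fin; toℕ; fromℕ<)
open import Data.Bool using (Bool; true; false; if_then_else_; _∧_; _∨_; not)
open import Data.List using (List; []; _∷_; foldl; allFin; tabulate; map; concat)
open import Data.List.Relation.Unary.Any using (Any)
open import Data.List.Membership.Propositional using (_∈_)
open import Data.Sum using (_⊎_; inj₁; inj₂)
open import Data.Product using (Σ; _×_; _,_; ∃)
open import Relation.Binary.PropositionalEquality using (_≡_)
open import Relation.Nullary using (¬_; yes; no)

data Term : Set where
  var : ℕ → Term
  fn  : ℕ → List Term → Term

data _occT_ (y : ℕ) : Term → Set where
  here : y occT var y
  inFn : ∀ {f ts} → Any (y occT_) ts → y occT fn f ts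

mutual
  substT : ℕ → Term → Term → Term
  substT y r (var z) = if z ≡ᵇ y then r else var z
  substT y r (fn f ts) = fn f (substTs y r ts)

  substTs : ℕ → Term → List Term → List Term
  substTs y r [] = []
  substTs y r (t ∷ ts) = substT y r t ∷ substTs y r ts

data Fm (A : Set) : Set where
  atom : A → Fm A
  ⊤ᶠ ⊥ᶠ : Fm A
  ¬ᶠ_  : Fm A → Fm A
  _∧ᶠ_ _∨ᶠ_ _⊃ᶠ_ : Fm A → Fm A → Fm A

data Atom : Set where
  pred : ℕ → List Term → Atom

bindFm : {A B : Set} → (A → Fm B) → Fm A → Fm B
bindFm g (atom a) = g a
bindFm g ⊤ᶠ = ⊤ᶠ
bindFm g ⊥ᶠ = ⊥ᶠ
bindFm g (¬ᶠ φ) = ¬ᶠ bindFm g φ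
bindFm g (φ ∧ᶠ ψ) = bindFm g φ ∧ᶠ bindFm g ψ
bindFm g (φ ∨ᶠ ψ) = bindFm g φ ∨ᶠ bindFm g ψ
bindFm g (φ ⊃ᶠ ψ) = bindFm g φ ⊃ᶠ bindFm g ψ

Formula : Set
Formula = Fm Atom

substF : ℕ → Term → Formula → Formula
substF y r = bindFm (λ { (pred p ts) → atom (pred p (substTs y r ts)) })

data _occF_ (y : ℕ) : Formula → Set where
  inAtom : ∀ {p ts} → Any (y occT_) ts → y occF atom (pred p ts)
  inNeg  : ∀ {φ} → y occF φ → y occF (¬ᶠ φ)
  inAndˡ : ∀ {φ ψ} → y occF φ → y occF (φ ∧ᶠ ψ)
  inAndʳ : ∀ {φ ψ} → y occF ψ → y occF (φ ∧ᶠ ψ)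
  inOrˡ  : ∀ {φ ψ} → y occF φ → y occF (φ ∨ᶠ ψ)
  inOrʳ  : ∀ {φ ψ} → y occF ψ → y occF (φ ∨ᶠ ψ)
  inImpˡ : ∀ {φ ψ} → y occF φ → y occF (φ ⊃ᶠ ψ)
  inImpʳ : ∀ {φ ψ} → y occF ψ → y occF (φ ⊃ᶠ ψ)

bigAnd : {A : Set} (k : ℕ) → (Fin k → Fm A) → Fm A
bigAnd zero f = ⊤ᶠ
bigAnd (suc k) f = f Fin.zero ∧ᶠ bigAnd k (λ j → f (Fin.suc j))

-- Propositional semantics: atoms are propositional variables

Valuation : Set
Valuation = ℕ → List Term → Bool

⟦_⟧ : Formula → Valuation → Bool
⟦ atom (pred p ts) ⟧ v = v p ts
⟦ ⊤ᶠ ⟧ v = true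
⟦ ⊥ᶠ ⟧ v = false
⟦ ¬ᶠ φ ⟧ v = not (⟦ φ ⟧ v)
⟦ φ ∧ᶠ ψ ⟧ v = ⟦ φ ⟧ v ∧ ⟦ ψ ⟧ v
⟦ φ ∨ᶠ ψ ⟧ v = ⟦ φ ⟧ v ∨ ⟦ ψ ⟧ v
⟦ φ ⊃ᶠ ψ ⟧ v = not (⟦ φ ⟧ v) ∨ ⟦ ψ ⟧ v

-- The sequent  Γ →  (antecedent given as a set of formulas, empty
-- succedent) is a tautology: no valuation makes all of Γ true.
TautSeq : (Formula → Set) → Set
TautSeq Γ = (v : Valuation) → ¬ ((φ : Formula) → Γ φ → ⟦ φ ⟧ v ≡ true)

-- Data of  F{x↦u₁},…,F{x↦uₘ}, X₁(α₁) ⊃ ⋀ⱼ X₁(s₁ⱼ), …, Xₙ(αₙ) ⊃ ⋀ⱼ Xₙ(sₙⱼ) →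
-- Indices are 0-based: nonterminal i : Fin n stands for αᵢ₊₁ of the paper.
record SchemData : Set where
  field
    F : Formula
    x : ℕ
    m : ℕ
    u : Fin m → Term
    n : ℕ
    α : Fin n → ℕ
    k : Fin n → ℕ
    s : (i : Fin n) → Fin (k i) → Term

module _ (H : SchemData) where
  open SchemData H

  SAtom : Set
  SAtom = Atom ⊎ (Fin n × Term)

  lift : Formula → Fm SAtom
  lift = bindFm (λ a → atom (inj₁ a))

  X : Fin n → Term → Fm SAtom
  X i t = atom (inj₂ (i , t))

  seqH : List (Fm SAtom)
  seqH = Data.List._++_
           (tabulate (λ (i : Fin m) → lift (substF x (u i) F)))
           (tabulate (λ (i : Fin n) →
              X i (var (α i)) ⊃ᶠ bigAnd (k i) (λ j → X i (s i j))))

  -- Language of the totally rigid grammar G(H) with productions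
  -- τ → uₗ and αᵢ → sᵢⱼ : a derivation picks one start production and,
  -- rigidly, one production per nonterminal αᵢ; since sᵢⱼ only contains
  -- α's of larger index, the αᵢ are eliminated in the order α₁,…,αₙ.
  derive : Fin m → ((i : Fin n) → Fin (k i)) → Term
  derive l c = foldl (λ t i → substT (α i) (s i (c i)) t) (u l) (allFin n)

  InLang : Term → Set
  InLang t = Σ (Fin m) λ l → Σ ((i : Fin n) → Fin (k i)) λ c → t ≡ derive l c

  record IsSEHS : Set where
    field
      F-vars   : ∀ y → y occF F → y ≡ x
      α-inj    : ∀ i j → α i ≡ α j → i ≡ j
      u-vars   : ∀ l y → y occT u l → ∃ λ i → y ≡ α i
      s-vars   : ∀ i j y → y occT s i j → ∃ λ l → (i Fin.< l) × (y ≡ α l)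
      herbrand : TautSeq (λ φ → Σ Term λ t → InLang t × (φ ≡ substF x t F))

  -- Applying the substitution [Xᵢ ↦ λαᵢ.Aᵢ] (with β-reduction)
  instantiate : (Fin n → Formula) → Fm SAtom → Formula
  instantiate A = bindFm inst
    where
    inst : SAtom → Formula
    inst (inj₁ a) = atom a
    inst (inj₂ (i , t)) = substF (α i) t (A i)

  IsSolution : (Fin n → Formula) → Set
  IsSolution A =
    (∀ i y → y occF A i → ∃ λ l → (i Fin.≤ l) × (y ≡ α l))
    × TautSeq (λ φ → Σ (Fm SAtom) λ ψ → ψ ∈ seqH × (φ ≡ instantiate A ψ))

  canonℕ : ℕ → Formula
  canonℕ zero = bigAnd m (λ l → substF x (u l) F)
  canonℕ (suc i) with i <? n
  ... | yes p = bigAnd (k (fromℕ< p))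
                  (λ j → substF (α (fromℕ< p)) (s (fromℕ< p) j) (canonℕ i))
  ... | no _ = ⊤ᶠ

  canonical : Fin n → Formula
  canonical i = canonℕ (toℕ i)

-- Write Cⱼ for canonℕ H j (the paper's Cⱼ₊₁; the last one, Cₙ, is not part of the substitution).
-- Under the canonical substitution the first m formulas of H conjoin to C₀ and the i-th
-- implication becomes Cᵢ ⊃ Cᵢ₊₁, so a valuation satisfying the instantiated sequent satisfies
-- C₀, …, Cₙ. Conversely Cⱼ entails F{x ↦ t} for every t obtained from some uₗ by eliminating
-- α₀, …, αⱼ₋₁. The induction on j has to range over all valuations: Cⱼ{αⱼ ↦ r} holds under v
-- iff Cⱼ holds under v precomposed with {αⱼ ↦ r} on atoms, and F{x ↦ t}{αⱼ ↦ r} = F{x ↦ t{αⱼ ↦ r}}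
-- because x is the only variable of F. For j = n these are the instances over L(G(H)), which
-- no valuation satisfies. The variable condition holds because Cⱼ₊₁ replaces αⱼ by terms in
-- αⱼ₊₁, …, αₙ₋₁.

module Submission where

open import Defs
open import Data.Nat using (ℕ; zero; suc; _≤_; _≡ᵇ_; _<?_; z≤n)
open import Data.Nat.Properties using (≡ᵇ⇒≡; ≡⇒≡ᵇ; <⇒≤; ≤∧≢⇒<; ≤-refl; ≤-reflexive)
open import Data.Fin using (Fin; toℕ; fromℕ<)
open import Data.Fin.Properties using (toℕ<n; toℕ-fromℕ<; fromℕ<-toℕ; toℕ-injective)
open import Data.Bool using (true; false; not; _∧_; _∨_; T)
open import Data.Unit using (tt)
open import Data.Empty using (⊥-elim)
open import Data.List using (List; []; _∷_; foldl; allFin; take)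
open import Data.List.Properties using (take-suc-tabulate; take-all; foldl-∷ʳ; length-tabulate)
open import Data.List.Relation.Unary.Any using (Any; here; there)
open import Data.List.Membership.Propositional using (_∈_)
open import Data.List.Membership.Propositional.Properties using (∈-++⁺ˡ; ∈-++⁺ʳ; ∈-tabulate⁺)
open import Data.Sum using (_⊎_; inj₁; inj₂)
open import Data.Product using (_×_; _,_; ∃)
import Data.Sum as Sum
import Data.Product as Product
open import Function using (id; _∘_)
open import Relation.Binary.PropositionalEquality
open import Relation.Nullary using (yes; no)

upTo-induction : ∀ {ℓ n} (P : ℕ → Set ℓ) → P 0 →
                 (∀ (i : Fin n) → P (toℕ i) → P (suc (toℕ i))) →
                 ∀ j → j ≤ n → P j
upTo-induction P P₀ Pₛ zero _ = P₀
upTo-induction P P₀ Pₛ (suc j) j<n =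
  subst (P ∘ suc) (toℕ-fromℕ< j<n)
    (Pₛ (fromℕ< j<n) (subst P (sym (toℕ-fromℕ< j<n)) (upTo-induction P P₀ Pₛ j (<⇒≤ j<n))))

≡ᵇ-refl : ∀ y → (y ≡ᵇ y) ≡ true
≡ᵇ-refl zero = refl
≡ᵇ-refl (suc y) = ≡ᵇ-refl y

mutual
  substT-id : ∀ y (w : Term) → substT y (var y) w ≡ w
  substT-id y (var z) with z ≡ᵇ y in eq
  ... | true = cong var (sym (≡ᵇ⇒≡ z y (subst T (sym eq) tt)))
  ... | false = refl
  substT-id y (fn f ws) = cong (fn f) (substTs-id y ws)

  substTs-id : ∀ y (ws : List Term) → substTs y (var y) ws ≡ ws
  substTs-id y [] = refl
  substTs-id y (w ∷ ws) = cong₂ _∷_ (substT-id y w) (substTs-id y ws)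

mutual
  substT-substT : ∀ x t y r (w : Term) → (∀ z → z occT w → z ≡ x) →
                  substT y r (substT x t w) ≡ substT x (substT y r t) w
  substT-substT x t y r (var z) only-x with only-x z here
  ... | refl rewrite ≡ᵇ-refl z = refl
  substT-substT x t y r (fn f ws) only-x =
    cong (fn f) (substTs-substTs x t y r ws (λ z → only-x z ∘ inFn))

  substTs-substTs : ∀ x t y r (ws : List Term) → (∀ z → Any (z occT_) ws → z ≡ x) →
                    substTs y r (substTs x t ws) ≡ substTs x (substT y r t) ws
  substTs-substTs x t y r [] only-x = refl
  substTs-substTs x t y r (w ∷ ws) only-x =
    cong₂ _∷_ (substT-substT x t y r w (λ z → only-x z ∘ here))
              (substTs-substTs x t y r ws (λ z → only-x z ∘ there))

mutual
  occT-substT : ∀ {z} y r (w : Term) → z occT substT y r w → (z occT w × z ≢ y) ⊎ z occT r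
  occT-substT y r (var w) o with w ≡ᵇ y in eq
  occT-substT y r (var w) o    | true = inj₂ o
  occT-substT y r (var w) here | false = inj₁ (here , λ w≡y → subst T eq (≡⇒≡ᵇ w y w≡y))
  occT-substT y r (fn f ws) (inFn o) = Sum.map₁ (Product.map₁ inFn) (occTs-substTs y r ws o)

  occTs-substTs : ∀ {z} y r (ws : List Term) → Any (z occT_) (substTs y r ws) →
                  (Any (z occT_) ws × z ≢ y) ⊎ z occT r
  occTs-substTs y r (w ∷ ws) (here o) = Sum.map₁ (Product.map₁ here) (occT-substT y r w o)
  occTs-substTs y r (w ∷ ws) (there o) = Sum.map₁ (Product.map₁ there) (occTs-substTs y r ws o)

module _ {A : Set} where

  bindFm-id : {g : A → Fm A} → (∀ a → g a ≡ atom a) → ∀ φ → bindFm g φ ≡ φ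
  bindFm-id g≗atom (atom a) = g≗atom a
  bindFm-id g≗atom ⊤ᶠ = refl
  bindFm-id g≗atom ⊥ᶠ = refl
  bindFm-id g≗atom (¬ᶠ φ) = cong ¬ᶠ_ (bindFm-id g≗atom φ)
  bindFm-id g≗atom (φ ∧ᶠ ψ) = cong₂ _∧ᶠ_ (bindFm-id g≗atom φ) (bindFm-id g≗atom ψ)
  bindFm-id g≗atom (φ ∨ᶠ ψ) = cong₂ _∨ᶠ_ (bindFm-id g≗atom φ) (bindFm-id g≗atom ψ)
  bindFm-id g≗atom (φ ⊃ᶠ ψ) = cong₂ _⊃ᶠ_ (bindFm-id g≗atom φ) (bindFm-id g≗atom ψ)

  bindFm-bindFm : ∀ {B C : Set} (f : A → Fm B) (g : B → Fm C) φ →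
                  bindFm g (bindFm f φ) ≡ bindFm (bindFm g ∘ f) φ
  bindFm-bindFm f g (atom a) = refl
  bindFm-bindFm f g ⊤ᶠ = refl
  bindFm-bindFm f g ⊥ᶠ = refl
  bindFm-bindFm f g (¬ᶠ φ) = cong ¬ᶠ_ (bindFm-bindFm f g φ)
  bindFm-bindFm f g (φ ∧ᶠ ψ) = cong₂ _∧ᶠ_ (bindFm-bindFm f g φ) (bindFm-bindFm f g ψ)
  bindFm-bindFm f g (φ ∨ᶠ ψ) = cong₂ _∨ᶠ_ (bindFm-bindFm f g φ) (bindFm-bindFm f g ψ)
  bindFm-bindFm f g (φ ⊃ᶠ ψ) = cong₂ _⊃ᶠ_ (bindFm-bindFm f g φ) (bindFm-bindFm f g ψ)

  bindFm-bigAnd : ∀ {B : Set} (g : A → Fm B) k (f : Fin k → Fm A) →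
                  bindFm g (bigAnd k f) ≡ bigAnd k (bindFm g ∘ f)
  bindFm-bigAnd g zero f = refl
  bindFm-bigAnd g (suc k) f = cong (bindFm g (f Fin.zero) ∧ᶠ_) (bindFm-bigAnd g k (f ∘ Fin.suc))

⟦bindFm⟧ : ∀ (g : Atom → Formula) φ v → ⟦ bindFm g φ ⟧ v ≡ ⟦ φ ⟧ (λ p ts → ⟦ g (pred p ts) ⟧ v)
⟦bindFm⟧ g (atom (pred p ts)) v = refl
⟦bindFm⟧ g ⊤ᶠ v = refl
⟦bindFm⟧ g ⊥ᶠ v = refl
⟦bindFm⟧ g (¬ᶠ φ) v = cong not (⟦bindFm⟧ g φ v)
⟦bindFm⟧ g (φ ∧ᶠ ψ) v = cong₂ _∧_ (⟦bindFm⟧ g φ v) (⟦bindFm⟧ g ψ v)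
⟦bindFm⟧ g (φ ∨ᶠ ψ) v = cong₂ _∨_ (⟦bindFm⟧ g φ v) (⟦bindFm⟧ g ψ v)
⟦bindFm⟧ g (φ ⊃ᶠ ψ) v = cong₂ (λ a b → not a ∨ b) (⟦bindFm⟧ g φ v) (⟦bindFm⟧ g ψ v)

substF-id : ∀ y φ → substF y (var y) φ ≡ φ
substF-id y = bindFm-id λ { (pred p ts) → cong (atom ∘ pred p) (substTs-id y ts) }

substF-substF : ∀ x t y r φ → (∀ z → z occF φ → z ≡ x) →
                substF y r (substF x t φ) ≡ substF x (substT y r t) φ
substF-substF x t y r (atom (pred p ts)) only-x =
  cong (atom ∘ pred p) (substTs-substTs x t y r ts (λ z → only-x z ∘ inAtom))
substF-substF x t y r ⊤ᶠ only-x = refl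
substF-substF x t y r ⊥ᶠ only-x = refl
substF-substF x t y r (¬ᶠ φ) only-x = cong ¬ᶠ_ (substF-substF x t y r φ (λ z → only-x z ∘ inNeg))
substF-substF x t y r (φ ∧ᶠ ψ) only-x =
  cong₂ _∧ᶠ_ (substF-substF x t y r φ (λ z → only-x z ∘ inAndˡ))
             (substF-substF x t y r ψ (λ z → only-x z ∘ inAndʳ))
substF-substF x t y r (φ ∨ᶠ ψ) only-x =
  cong₂ _∨ᶠ_ (substF-substF x t y r φ (λ z → only-x z ∘ inOrˡ))
             (substF-substF x t y r ψ (λ z → only-x z ∘ inOrʳ))
substF-substF x t y r (φ ⊃ᶠ ψ) only-x =
  cong₂ _⊃ᶠ_ (substF-substF x t y r φ (λ z → only-x z ∘ inImpˡ))
             (substF-substF x t y r ψ (λ z → only-x z ∘ inImpʳ))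

occF-substF : ∀ {z} y r φ → z occF substF y r φ → (z occF φ × z ≢ y) ⊎ z occT r
occF-substF y r (atom (pred p ts)) (inAtom o) = Sum.map₁ (Product.map₁ inAtom) (occTs-substTs y r ts o)
occF-substF y r (¬ᶠ φ) (inNeg o) = Sum.map₁ (Product.map₁ inNeg) (occF-substF y r φ o)
occF-substF y r (φ ∧ᶠ ψ) (inAndˡ o) = Sum.map₁ (Product.map₁ inAndˡ) (occF-substF y r φ o)
occF-substF y r (φ ∧ᶠ ψ) (inAndʳ o) = Sum.map₁ (Product.map₁ inAndʳ) (occF-substF y r ψ o)
occF-substF y r (φ ∨ᶠ ψ) (inOrˡ o) = Sum.map₁ (Product.map₁ inOrˡ) (occF-substF y r φ o)
occF-substF y r (φ ∨ᶠ ψ) (inOrʳ o) = Sum.map₁ (Product.map₁ inOrʳ) (occF-substF y r ψ o)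
occF-substF y r (φ ⊃ᶠ ψ) (inImpˡ o) = Sum.map₁ (Product.map₁ inImpˡ) (occF-substF y r φ o)
occF-substF y r (φ ⊃ᶠ ψ) (inImpʳ o) = Sum.map₁ (Product.map₁ inImpʳ) (occF-substF y r ψ o)

occF-bigAnd : ∀ {z} k (f : Fin k → Formula) → z occF bigAnd k f → ∃ λ j → z occF f j
occF-bigAnd (suc k) f (inAndˡ o) = Fin.zero , o
occF-bigAnd (suc k) f (inAndʳ o) = Product.map Fin.suc id (occF-bigAnd k (f ∘ Fin.suc) o)

infix 4 _⊨_
_⊨_ : Valuation → Formula → Set
v ⊨ φ = ⟦ φ ⟧ v ≡ true

⊨-bigAnd⁻ : ∀ {v} k (f : Fin k → Formula) → v ⊨ bigAnd k f → ∀ j → v ⊨ f j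
⊨-bigAnd⁻ {v} (suc k) f ⊨f with ⟦ f Fin.zero ⟧ v in eq
⊨-bigAnd⁻ (suc k) f ⊨f | true = λ { Fin.zero → eq ; (Fin.suc j) → ⊨-bigAnd⁻ k (f ∘ Fin.suc) ⊨f j }

⊨-bigAnd⁺ : ∀ {v} k (f : Fin k → Formula) → (∀ j → v ⊨ f j) → v ⊨ bigAnd k f
⊨-bigAnd⁺ zero f ⊨f = refl
⊨-bigAnd⁺ (suc k) f ⊨f rewrite ⊨f Fin.zero = ⊨-bigAnd⁺ k (f ∘ Fin.suc) (⊨f ∘ Fin.suc)

⊨-mp : ∀ {v} φ ψ → v ⊨ φ ⊃ᶠ ψ → v ⊨ φ → v ⊨ ψ
⊨-mp {v} φ ψ ⊨φ⊃ψ ⊨φ rewrite ⊨φ = ⊨φ⊃ψ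

module _ (H : SchemData) where
  open SchemData H

  instantiate-lift : ∀ A φ → instantiate H A (lift H φ) ≡ φ
  instantiate-lift A φ = trans (bindFm-bindFm _ _ φ) (bindFm-id (λ _ → refl) φ)

  canonℕ-suc : ∀ i →
               canonℕ H (suc (toℕ i)) ≡ bigAnd (k i) (λ j → substF (α i) (s i j) (canonical H i))
  canonℕ-suc i with toℕ i <? n
  ... | yes i<n rewrite fromℕ<-toℕ i i<n = refl
  ... | no i≮n = ⊥-elim (i≮n (toℕ<n i))

  deriveUpTo : ℕ → Fin m → ((i : Fin n) → Fin (k i)) → Term
  deriveUpTo j l c = foldl (λ t i → substT (α i) (s i (c i)) t) (u l) (take j (allFin n))

  deriveUpTo-suc : ∀ i l c →
                   deriveUpTo (suc (toℕ i)) l c ≡ substT (α i) (s i (c i)) (deriveUpTo (toℕ i) l c)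
  deriveUpTo-suc i l c =
    trans (cong (foldl _ (u l)) (take-suc-tabulate id i)) (foldl-∷ʳ _ (u l) i (take (toℕ i) (allFin n)))

  deriveUpTo-all : ∀ l c → deriveUpTo n l c ≡ derive H l c
  deriveUpTo-all l c = cong (foldl _ (u l)) (take-all n (allFin n) (≤-reflexive (length-tabulate id)))

  VarsFrom : ℕ → Formula → Set
  VarsFrom j φ = ∀ y → y occF φ → ∃ λ l → j ≤ toℕ l × y ≡ α l

  canonical-vars : IsSEHS H → ∀ j → j ≤ n → VarsFrom j (canonℕ H j)
  canonical-vars S = upTo-induction (λ j → VarsFrom j (canonℕ H j)) base step
    where
    open IsSEHS S
    base : VarsFrom 0 (canonℕ H 0)
    base y o with occF-bigAnd m _ o
    ... | l , o′ with occF-substF x (u l) F o′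
    ...   | inj₁ (o″ , y≢x) = ⊥-elim (y≢x (F-vars y o″))
    ...   | inj₂ o″ = Product.map₂ (z≤n ,_) (u-vars l y o″)
    step : ∀ i → VarsFrom (toℕ i) (canonical H i) → VarsFrom (suc (toℕ i)) (canonℕ H (suc (toℕ i)))
    step i ih y o with occF-bigAnd (k i) _ (subst (y occF_) (canonℕ-suc i) o)
    ... | j , o′ with occF-substF (α i) (s i j) (canonical H i) o′
    ...   | inj₂ o″ = s-vars i j y o″
    ...   | inj₁ (o″ , y≢αᵢ) with ih y o″
    ...     | l , i≤l , refl = l , ≤∧≢⇒< i≤l (λ i≡l → y≢αᵢ (cong α (sym (toℕ-injective i≡l)))) , refl

  canonical-holds : ∀ {v} → (∀ ψ → ψ ∈ seqH H → v ⊨ instantiate H (canonical H) ψ) →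
                    ∀ j → j ≤ n → v ⊨ canonℕ H j
  canonical-holds {v} ⊨σH = upTo-induction (λ j → v ⊨ canonℕ H j) base step
    where
    σ = instantiate H (canonical H)
    base : v ⊨ canonℕ H 0
    base = ⊨-bigAnd⁺ m _ λ l →
      subst (v ⊨_) (instantiate-lift (canonical H) (substF x (u l) F)) (⊨σH _ (∈-++⁺ˡ (∈-tabulate⁺ l)))
    step : ∀ i → v ⊨ canonical H i → v ⊨ canonℕ H (suc (toℕ i))
    step i ⊨Cᵢ = subst (v ⊨_) (sym (canonℕ-suc i)) (subst (v ⊨_) (bindFm-bigAnd _ (k i) _) ⊨σ⋀Xᵢsᵢⱼ)
      where
      Xᵢαᵢ = X H i (var (α i))
      ⋀Xᵢsᵢⱼ = bigAnd (k i) (X H i ∘ s i)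
      ⊨σXᵢαᵢ : v ⊨ σ Xᵢαᵢ
      ⊨σXᵢαᵢ = subst (v ⊨_) (sym (substF-id (α i) (canonical H i))) ⊨Cᵢ
      ⊨σ⋀Xᵢsᵢⱼ : v ⊨ σ ⋀Xᵢsᵢⱼ
      ⊨σ⋀Xᵢsᵢⱼ =
        ⊨-mp (σ Xᵢαᵢ) (σ ⋀Xᵢsᵢⱼ) (⊨σH (Xᵢαᵢ ⊃ᶠ ⋀Xᵢsᵢⱼ) (∈-++⁺ʳ _ (∈-tabulate⁺ i))) ⊨σXᵢαᵢ

  EntailsInstances : ℕ → Set
  EntailsInstances j = ∀ v → v ⊨ canonℕ H j → ∀ l c → v ⊨ substF x (deriveUpTo j l c) F

  canonical⇒instances : (∀ y → y occF F → y ≡ x) → ∀ j → j ≤ n → EntailsInstances j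
  canonical⇒instances F-vars = upTo-induction EntailsInstances base step
    where
    base : EntailsInstances 0
    base v ⊨C₀ l c = ⊨-bigAnd⁻ m _ ⊨C₀ l
    step : ∀ i → EntailsInstances (toℕ i) → EntailsInstances (suc (toℕ i))
    step i ih v ⊨Cᵢ₊₁ l c = begin
      ⟦ substF x (deriveUpTo (suc (toℕ i)) l c) F ⟧ v ≡⟨ cong (λ t → ⟦ substF x t F ⟧ v) (deriveUpTo-suc i l c) ⟩
      ⟦ substF x (substT (α i) r t) F ⟧ v            ≡⟨ cong (λ φ → ⟦ φ ⟧ v) (substF-substF x t (α i) r F F-vars) ⟨
      ⟦ substF (α i) r (substF x t F) ⟧ v            ≡⟨ ⟦bindFm⟧ _ (substF x t F) v ⟩
      ⟦ substF x t F ⟧ v′                           ≡⟨ ih v′ v′⊨Cᵢ l c ⟩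
      true                                          ∎
      where
      open ≡-Reasoning
      r = s i (c i)
      t = deriveUpTo (toℕ i) l c
      v′ : Valuation
      v′ p ts = v p (substTs (α i) r ts)
      v′⊨Cᵢ : v′ ⊨ canonical H i
      v′⊨Cᵢ = trans (sym (⟦bindFm⟧ _ (canonical H i) v))
                    (⊨-bigAnd⁻ (k i) _ (subst (v ⊨_) (canonℕ-suc i) ⊨Cᵢ₊₁) (c i))

lemma3 : (H : SchemData) → IsSEHS H → IsSolution H (canonical H)
lemma3 H S =
  (λ i → canonical-vars H S (toℕ i) (<⇒≤ (toℕ<n i))) ,
  λ v ⊨σH → herbrand v λ where
    _ (_ , (l , c , refl) , refl) →
      let ⊨Cₙ = canonical-holds H (λ ψ ψ∈H → ⊨σH _ (ψ , ψ∈H , refl)) n ≤-refl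
      in subst (λ t → v ⊨ substF x t F) (deriveUpTo-all H l c)
               (canonical⇒instances H F-vars n ≤-refl v ⊨Cₙ l c)
  where
  open SchemData H
  open IsSEHS S
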